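{- Let $N$ be a set of labelled clauses over a finite signature $\Sigma$ and let $p \in \Sigma$ be a variable such that no labelled clause in $N$ contains more than one occurrence of a literal over $\{p^{(i)} : i \in \mathbb{N}\}$. Split $N = N_p \cup N_{\neg p} \cup N_0$, where $N_p$ consists of the labelled clauses containing some $p^{(i)}$ positively, $N_{\neg p}$ of those containing some $p^{(i)}$ negatively, and $N_0$ of those containing no $p^{(i)}$ at all. Let $N_p \otimes N_{\neg p}$ be the set of all labelled resolvents obtained by labelled resolution on an atom $p^{(i)}$ between a clause of $N_p$ and a clause of $N_{\neg p}$, where one of the two premises may first be replaced by the result of applying the time shift operation (finitely many times) to it, and let $\overline{N} = (N_p \otimes N_{\neg p}) \cup N_0$. Then for every $K \in \mathbb{N}$ and $L \in \mathbb{N}^+$, $N$ is $(K,L)$-satisfiable if and only if $\overline{N}$ is $(K,L)$-satisfiable.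
   Context: $\Sigma$ is a finite set of propositional variables. For each $i \in \mathbb{N}$ let $\Sigma^{(i)} = \{p^{(i)} : p \in \Sigma\}$ be pairwise disjoint copies of $\Sigma$ (with $p^{(0)} = p$, $p^{(1)} = p'$), and $\Sigma^* = \bigcup_{i} \Sigma^{(i)}$. A standard clause is a finite set (disjunction) of literals over $\Sigma^*$. For a standard clause $C$ and $t \in \mathbb{N}$, $C^{(t)}$ is obtained by replacing every variable $q^{(i)}$ in $C$ by $q^{(i+t)}$; we write $C'$ for $C^{(1)}$. A label is a triple $(b,k,l) \in \{*,0\} \times (\{*\} \cup \mathbb{N}) \times \mathbb{N}$; a labelled clause $\langle (b,k,l) \rangle C$ is a pair of a label and a standard clause. For $K \in \mathbb{N}$, $L \in \mathbb{N}^+$, the set $R_{(K,L)}(b,k,l)$ consists of all $t \in \mathbb{N}$ such that (1) if $b \neq *$ then $t = 0$; (2) if $k \neq *$ then $t + k = K + sL$ for some $s \in \mathbb{N}$; (3) $L$ divides $l$. For a set $N$ of labelled clauses, $N_{(K,L)} = \{C^{(t)} : \langle (b,k,l)\rangle C \in N,\ t \in R_{(K,L)}(b,k,l)\}$, and $N$ is $(K,L)$-satisfiable if some valuation $W^*: \Sigma^* \to \{0,1\}$ propositionally satisfies every clause of $N_{(K,L)}$. Labelled resolution: from $\langle (b_1,k_1,l_1)\rangle A \lor C$ and $\langle (b_2,k_2,l_2)\rangle \neg A \lor D$ ($A$ an atom of $\Sigma^*$) derive $\langle (b,k,l)\rangle C \lor D$, where the merge $(b,k,l)$ is: $b = b_2$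 if $b_1 = *$, else $b = b_1$ if $b_2 = *$, else $b = 0$; $k = k_2$ if $k_1 = *$, else $k = k_1$ if $k_2 = *$, else $k = \min(k_1,k_2)$; $l = \gcd(l_1,l_2)$ if $k_1 = *$ or $k_2 = *$, else $l = \gcd(l_1,l_2,k_1-k_2)$ (with $\gcd$ taken of absolute values and $\gcd(x,0)=x$). Time shift: $\langle (*,*,l)\rangle C \leadsto \langle (*,*,l)\rangle C'$ and $\langle (*,k,l)\rangle C \leadsto \langle (*,k+1,l)\rangle C'$ for $k \in \mathbb{N}$; it is undefined for labelled clauses whose first label component is $0$. -}

module Defs where

open import Data.Nat using (ℕ; zero; suc; _+_; _*_; _≤_; _⊓_; ∣_-_∣)
open import Data.Nat.Divisibility using (_∣_)
open import Data.Nat.GCD using (gcd)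
open import Data.Fin using (Fin)
import Data.Fin.Properties as FinP
open import Data.Bool using (Bool; true; false)
open import Data.Maybe using (Maybe; just; nothing)
import Data.Maybe as Maybe
open import Data.Product using (Σ; ∃; _×_; _,_; proj₁)
open import Data.Sum using (_⊎_)
open import Data.List using (List; map; filter; length; _++_)
open import Data.List.Relation.Unary.Any using (Any)
open import Data.List.Relation.Unary.All using (All)
open import Data.List.Membership.Propositional using (_∈_)
open import Relation.Nullary using (¬_; ¬?; Dec)
open import Relation.Binary.PropositionalEquality using (_≡_)
open import Relation.Binary.Construct.Closure.ReflexiveTransitive using (Star)
import Data.Nat.Properties as NatP
open import Data.Product.Properties using (≡-dec)

-- The signature Σ is Fin n.  An atom p^(i) of Σ* is the pair (p , i).
Atom : ℕ → Set
Atom n = Fin n × ℕ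

_≟A_ : ∀ {n} (a b : Atom n) → Dec (a ≡ b)
_≟A_ = ≡-dec FinP._≟_ NatP._≟_

data Lit (n : ℕ) : Set where
  pos : Atom n → Lit n
  neg : Atom n → Lit n

atom : ∀ {n} → Lit n → Atom n
atom (pos a) = a
atom (neg a) = a

Clause : ℕ → Set
Clause n = List (Lit n)

shiftAtom : ∀ {n} → ℕ → Atom n → Atom n
shiftAtom t (q , i) = (q , i + t)

shiftLit : ∀ {n} → ℕ → Lit n → Lit n
shiftLit t (pos a) = pos (shiftAtom t a)
shiftLit t (neg a) = neg (shiftAtom t a)

shiftC : ∀ {n} → ℕ → Clause n → Clause n
shiftC t = map (shiftLit t)

-- labels (b , k , l); b ∈ {*, 0}, k ∈ {*} ∪ ℕ  (nothing = *)
data B : Set where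
  star : B
  zeroB : B

record Label : Set where
  constructor lab
  field
    b : B
    k : Maybe ℕ
    l : ℕ

record LClause (n : ℕ) : Set where
  constructor ⟨_⟩_
  field
    label : Label
    clause : Clause n
open LClause public

InR : ℕ → ℕ → Label → ℕ → Set
InR K L (lab b k l) t =
  (b ≡ zeroB → t ≡ 0) ×
  (∀ k′ → k ≡ just k′ → ∃ λ s → t + k′ ≡ K + s * L) ×
  (L ∣ l)

Valuation : ℕ → Set
Valuation n = Atom n → Bool

LitTrue : ∀ {n} → Valuation n → Lit n → Set
LitTrue W (pos a) = W a ≡ true
LitTrue W (neg a) = W a ≡ false

SatClause : ∀ {n} → Valuation n → Clause n → Set
SatClause W C = Any (LitTrue W) C

-- (K,L)-satisfiability of a (possibly infinite) set S of labelled clauses,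
-- given as a predicate: some W satisfies every clause of S_(K,L).
KLSat : ∀ {n} → ℕ → ℕ → (LClause n → Set) → Set
KLSat {n} K L S = Σ (Valuation n) λ W →
  ∀ lc → S lc → ∀ t → InR K L (label lc) t → SatClause W (shiftC t (clause lc))

mergeB : B → B → B
mergeB star b₂ = b₂
mergeB zeroB star = zeroB
mergeB zeroB zeroB = zeroB

mergeK : Maybe ℕ → Maybe ℕ → Maybe ℕ
mergeK nothing k₂ = k₂
mergeK (just k₁) nothing = just k₁
mergeK (just k₁) (just k₂) = just (k₁ ⊓ k₂)

mergeL : Maybe ℕ → Maybe ℕ → ℕ → ℕ → ℕ
mergeL (just k₁) (just k₂) l₁ l₂ = gcd (gcd l₁ l₂) ∣ k₁ - k₂ ∣
mergeL _ _ l₁ l₂ = gcd l₁ l₂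

merge : Label → Label → Label
merge (lab b₁ k₁ l₁) (lab b₂ k₂ l₂) = lab (mergeB b₁ b₂) (mergeK k₁ k₂) (mergeL k₁ k₂ l₁ l₂)

removeAtom : ∀ {n} → Atom n → Clause n → Clause n
removeAtom A = filter (λ x → ¬? (atom x ≟A A))

resolve : ∀ {n} → Atom n → LClause n → LClause n → LClause n
resolve A (⟨ λ₁ ⟩ C₁) (⟨ λ₂ ⟩ C₂) = ⟨ merge λ₁ λ₂ ⟩ (removeAtom A C₁ ++ removeAtom A C₂)

-- one time-shift step (undefined when b = 0)
data TimeShift {n : ℕ} : LClause n → LClause n → Set where
  ts : ∀ {k l C} →
       TimeShift (⟨ lab star k l ⟩ C) (⟨ lab star (Maybe.map suc k) l ⟩ shiftC 1 C)

TimeShifts : ∀ {n} → LClause n → LClause n → Set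
TimeShifts = Star TimeShift

IsP : ∀ {n} → Fin n → Lit n → Set
IsP p x = proj₁ (atom x) ≡ p

countP : ∀ {n} → Fin n → Clause n → ℕ
countP p C = length (filter (λ x → proj₁ (atom x) FinP.≟ p) C)

HasPosP : ∀ {n} → Fin n → LClause n → Set
HasPosP p lc = ∃ λ i → pos (p , i) ∈ clause lc

HasNegP : ∀ {n} → Fin n → LClause n → Set
HasNegP p lc = ∃ λ i → neg (p , i) ∈ clause lc

NoP : ∀ {n} → Fin n → LClause n → Set
NoP p lc = All (λ x → ¬ IsP p x) (clause lc)

Resolvents : ∀ {n} → List (LClause n) → Fin n → LClause n → Set
Resolvents N p r =
  Σ _ λ c₁ → Σ _ λ c₂ → c₁ ∈ N × HasPosP p c₁ × c₂ ∈ N × HasNegP p c₂ ×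
  Σ _ λ d₁ → Σ _ λ d₂ →
    ((TimeShifts c₁ d₁ × d₂ ≡ c₂) ⊎ (d₁ ≡ c₁ × TimeShifts c₂ d₂)) ×
    Σ ℕ λ i → pos (p , i) ∈ clause d₁ × neg (p , i) ∈ clause d₂ ×
    r ≡ resolve (p , i) d₁ d₂

Nbar : ∀ {n} → List (LClause n) → Fin n → LClause n → Set
Nbar N p r = Resolvents N p r ⊎ (r ∈ N × NoP p r)

{-# OPTIONS --safe #-}
-- (→) Every (K,L)-instance of a labelled resolvent is a propositional resolvent of
-- the instances of its premises at the same offset, since R(merge λ₁ λ₂) = R(λ₁) ∩ R(λ₂)
-- and a time shift only re-indexes instances; this propositional resolution is sound
-- because no premise contains both p^(i) and ¬p^(i).
-- (←) Given W satisfying N̄, keep W off p and make p^(j) false exactly when some clause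
-- of N has an instance containing ¬p^(j) whose other literals W all falsifies.  If an
-- instance containing p^(j) had all its other literals false too, time-shifting the
-- clause whose p-literal has the smaller index until the indices agree (by at most its
-- own instance offset, which is 0 when b = 0) would give a resolvent in N̄ with an
-- instance that W falsifies.
module Submission where

open import Defs
open import Data.Nat using (ℕ; zero; suc; s≤s; _+_; _*_; _∸_; _≤_; _<_; _⊓_; ∣_-_∣; _≤?_; _≟_)
open import Data.Nat.Properties
open import Data.Nat.Divisibility using (_∣_; divides; _∣?_; ∣-trans)
open import Data.Nat.GCD using (gcd; gcd[m,n]∣m; gcd[m,n]∣n; gcd-greatest)
open import Data.Fin using (Fin)
import Data.Fin.Properties as FinP
open import Data.Bool using (true; false; not; if_then_else_)
import Data.Bool.Properties as Bool
open import Data.Maybe using (Maybe; just; nothing)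
import Data.Maybe as Maybe
open import Data.List using (List; []; _∷_; length; _++_)
open import Data.List.Properties using (map-∘; map-cong; map-id)
open import Data.List.Relation.Unary.Any using (Any; here; any?)
import Data.List.Relation.Unary.Any as Any
import Data.List.Relation.Unary.Any.Properties as AnyP
open import Data.List.Relation.Unary.All using (All; all?)
import Data.List.Relation.Unary.All as All
import Data.List.Relation.Unary.All.Properties as AllP
open import Data.List.Membership.Propositional using (_∈_; lose; find)
open import Data.List.Membership.Propositional.Properties using (∈-map⁺; ∈-filter⁺; ∈-filter⁻)
open import Data.Product using (∃; _×_; _,_; proj₁; proj₂)
open import Data.Sum using (_⊎_; inj₁; inj₂; [_,_]′)
open import Data.Empty using (⊥)
open import Function using (_∘_; id)
open import Relation.Nullary using (¬_; Dec; yes; no; does; ¬?; _×-dec_; _→-dec_; contradiction)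
open import Relation.Nullary.Decidable using (dec-true; dec-false; map′; decidable-stable)
open import Relation.Unary using (Decidable)
open import Relation.Binary.PropositionalEquality
open import Relation.Binary.Construct.Closure.ReflexiveTransitive using (ε; _◅_)

private variable
  n : ℕ
  p : Fin n
  A : Atom n
  V W : Valuation n
  C C₁ C₂ : Clause n
  c c′ : LClause n

shiftAtom-+ : ∀ a b (x : Atom n) → shiftAtom a (shiftAtom b x) ≡ shiftAtom (b + a) x
shiftAtom-+ a b (q , i) = cong (q ,_) (+-assoc i b a)

shiftLit-+ : ∀ a b (x : Lit n) → shiftLit a (shiftLit b x) ≡ shiftLit (b + a) x
shiftLit-+ a b (pos x) = cong pos (shiftAtom-+ a b x)
shiftLit-+ a b (neg x) = cong neg (shiftAtom-+ a b x)

shiftC-+ : ∀ a b (C : Clause n) → shiftC a (shiftC b C) ≡ shiftC (b + a) C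
shiftC-+ a b C = trans (sym (map-∘ C)) (map-cong (shiftLit-+ a b) C)

shiftLit-zero : (x : Lit n) → shiftLit 0 x ≡ x
shiftLit-zero (pos (q , i)) = cong (λ j → pos (q , j)) (+-identityʳ i)
shiftLit-zero (neg (q , i)) = cong (λ j → neg (q , j)) (+-identityʳ i)

shiftC-zero : (C : Clause n) → shiftC 0 C ≡ C
shiftC-zero C = trans (map-cong shiftLit-zero C) (map-id C)

atom-shiftLit : ∀ t (x : Lit n) → atom (shiftLit t x) ≡ shiftAtom t (atom x)
atom-shiftLit t (pos _) = refl
atom-shiftLit t (neg _) = refl

countP-shiftC : ∀ (p : Fin n) t C → countP p (shiftC t C) ≡ countP p C
countP-shiftC p t [] = refl
countP-shiftC p t (pos (q , _) ∷ C) with q FinP.≟ p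
... | yes _ = cong suc (countP-shiftC p t C)
... | no  _ = countP-shiftC p t C
countP-shiftC p t (neg (q , _) ∷ C) with q FinP.≟ p
... | yes _ = cong suc (countP-shiftC p t C)
... | no  _ = countP-shiftC p t C

countP-timeShifts : ∀ (p : Fin n) → TimeShifts c c′ → countP p (clause c′) ≡ countP p (clause c)
countP-timeShifts p ε = refl
countP-timeShifts p (ts {C = C} ◅ shifts) = trans (countP-timeShifts p shifts) (countP-shiftC p 1 C)

resolventPremises : ∀ {c₁ c₂ d₁ d₂ : LClause n} →
                    (TimeShifts c₁ d₁ × d₂ ≡ c₂) ⊎ (d₁ ≡ c₁ × TimeShifts c₂ d₂) →
                    TimeShifts c₁ d₁ × TimeShifts c₂ d₂
resolventPremises (inj₁ (shifts , refl)) = shifts , ε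
resolventPremises (inj₂ (refl , shifts)) = ε , shifts

LitTrue? : (V : Valuation n) → Decidable (LitTrue V)
LitTrue? V (pos a) = V a Bool.≟ true
LitTrue? V (neg a) = V a Bool.≟ false

SatClause? : (V : Valuation n) → Decidable (SatClause V)
SatClause? V = any? (LitTrue? V)

IsP? : (p : Fin n) → Decidable (IsP p)
IsP? p x = proj₁ (atom x) FinP.≟ p

LitTrue-shiftLit⁻ : ∀ {t} (x : Lit n) → LitTrue V (shiftLit t x) → LitTrue (V ∘ shiftAtom t) x
LitTrue-shiftLit⁻ (pos _) = id
LitTrue-shiftLit⁻ (neg _) = id

LitTrue-shiftLit⁺ : ∀ {t} (x : Lit n) → LitTrue (V ∘ shiftAtom t) x → LitTrue V (shiftLit t x)
LitTrue-shiftLit⁺ (pos _) = id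
LitTrue-shiftLit⁺ (neg _) = id

LitTrue-shiftLit-+ : ∀ (W : Valuation n) d u x →
                     LitTrue (W ∘ shiftAtom u) (shiftLit d x) → LitTrue (W ∘ shiftAtom (d + u)) x
LitTrue-shiftLit-+ W d u (pos a) = subst (_≡ true) (cong W (shiftAtom-+ u d a))
LitTrue-shiftLit-+ W d u (neg a) = subst (_≡ false) (cong W (shiftAtom-+ u d a))

SatClause-shiftC⁻ : ∀ {t} → SatClause V (shiftC t C) → SatClause (V ∘ shiftAtom t) C
SatClause-shiftC⁻ = Any.map (LitTrue-shiftLit⁻ _) ∘ AnyP.map⁻

SatClause-shiftC⁺ : ∀ {t} → SatClause (V ∘ shiftAtom t) C → SatClause V (shiftC t C)
SatClause-shiftC⁺ = AnyP.map⁺ ∘ Any.map (LitTrue-shiftLit⁺ _)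

OnlyTrue : (Lit n → Set) → Valuation n → Clause n → Set
OnlyTrue P V C = All (λ x → LitTrue V x → P x) C

OnlyTrue? : ∀ {P : Lit n → Set} → Decidable P → (V : Valuation n) → Decidable (OnlyTrue P V)
OnlyTrue? P? V = all? (λ x → LitTrue? V x →-dec P? x)

AtAtom : Atom n → Lit n → Set
AtAtom A x = atom x ≡ A

OnlyTrue-shiftC : ∀ {W : Valuation n} d u → OnlyTrue (AtAtom A) (W ∘ shiftAtom (d + u)) C →
                  OnlyTrue (AtAtom (shiftAtom d A)) (W ∘ shiftAtom u) (shiftC d C)
OnlyTrue-shiftC {A = A} {W = W} d u = AllP.map⁺ ∘ All.map shifted
  where
  shifted : ∀ {x} → (LitTrue (W ∘ shiftAtom (d + u)) x → atom x ≡ A) →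
            LitTrue (W ∘ shiftAtom u) (shiftLit d x) → atom (shiftLit d x) ≡ shiftAtom d A
  shifted {x} only x-true =
    trans (atom-shiftLit d x) (cong (shiftAtom d) (only (LitTrue-shiftLit-+ W d u x x-true)))

SatClause-removeAtom : ∀ {ℓ} → SatClause V C → (∀ {x} → x ∈ C → atom x ≡ A → x ≡ ℓ) →
                       SatClause V (removeAtom A C) ⊎ LitTrue V ℓ
SatClause-removeAtom {V = V} {A = A} sat onlyℓ with find sat
... | x , x∈C , x-true with atom x ≟A A
...   | no  x≢A = inj₁ (lose (∈-filter⁺ (λ y → ¬? (atom y ≟A A)) x∈C x≢A) x-true)
...   | yes x≡A = inj₂ (subst (LitTrue V) (onlyℓ x∈C x≡A) x-true)

¬SatClause-removeAtom : OnlyTrue (AtAtom A) V C → ¬ SatClause V (removeAtom A C)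
¬SatClause-removeAtom {A = A} {C = C} only sat with find sat
... | x , x∈ , x-true with ∈-filter⁻ (λ y → ¬? (atom y ≟A A)) {xs = C} x∈
...   | x∈C , x≢A = x≢A (All.lookup only x∈C x-true)

resolvent-sound : SatClause V C₁ → SatClause V C₂ →
                  (∀ {x} → x ∈ C₁ → atom x ≡ A → x ≡ pos A) →
                  (∀ {x} → x ∈ C₂ → atom x ≡ A → x ≡ neg A) →
                  SatClause V (removeAtom A C₁ ++ removeAtom A C₂)
resolvent-sound sat₁ sat₂ only₁ only₂
  with SatClause-removeAtom sat₁ only₁ | SatClause-removeAtom sat₂ only₂
... | inj₁ rest₁ | _           = AnyP.++⁺ˡ rest₁
... | inj₂ _     | inj₁ rest₂  = AnyP.++⁺ʳ _ rest₂
... | inj₂ A-true | inj₂ A-false = contradiction (trans (sym A-true) A-false) λ ()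

resolvent-unsat : OnlyTrue (AtAtom A) V C₁ → OnlyTrue (AtAtom A) V C₂ →
                  ¬ SatClause V (removeAtom A C₁ ++ removeAtom A C₂)
resolvent-unsat only₁ only₂ sat =
  [ ¬SatClause-removeAtom only₁ , ¬SatClause-removeAtom only₂ ]′ (AnyP.++⁻ _ sat)

length≤1⇒∈-unique : ∀ {X : Set} {xs : List X} {x y} → length xs ≤ 1 → x ∈ xs → y ∈ xs → x ≡ y
length≤1⇒∈-unique {xs = _ ∷ []}    _         (here refl) (here refl) = refl
length≤1⇒∈-unique {xs = _ ∷ _ ∷ _} (s≤s ()) _           _

countP≤1⇒unique : ∀ {x y} → countP p C ≤ 1 → x ∈ C → y ∈ C → IsP p x → IsP p y → x ≡ y
countP≤1⇒unique {p = p} cnt x∈ y∈ px py =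
  length≤1⇒∈-unique cnt (∈-filter⁺ (IsP? p) x∈ px) (∈-filter⁺ (IsP? p) y∈ py)

countP≤1⇒onlyLiteral : ∀ {ℓ} → countP p C ≤ 1 → ℓ ∈ C → IsP p ℓ →
                       ∀ {x} → x ∈ C → atom x ≡ atom ℓ → x ≡ ℓ
countP≤1⇒onlyLiteral cnt ℓ∈ pℓ x∈ x≡ℓ =
  countP≤1⇒unique cnt x∈ ℓ∈ (trans (cong proj₁ x≡ℓ) pℓ) pℓ

equal-sums-offset : ∀ {i₁ t₁ i₂ t₂} → i₁ + t₁ ≡ i₂ + t₂ → i₁ ≤ i₂ →
                    ∃ λ d → i₂ ≡ i₁ + d × t₁ ≡ d + t₂
equal-sums-offset {i₁} {t₁} {_} {t₂} eq i₁≤i₂ with m≤n⇒∃[o]m+o≡n i₁≤i₂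
... | d , refl = d , refl , +-cancelˡ-≡ i₁ t₁ (d + t₂) (trans eq (+-assoc i₁ d t₂))

mergeB-zeroBˡ : ∀ b → mergeB zeroB b ≡ zeroB
mergeB-zeroBˡ star  = refl
mergeB-zeroBˡ zeroB = refl

mergeB-zeroBʳ : ∀ b → mergeB b zeroB ≡ zeroB
mergeB-zeroBʳ star  = refl
mergeB-zeroBʳ zeroB = refl

mergeB≡zeroB⁻ : ∀ b₁ b₂ → mergeB b₁ b₂ ≡ zeroB → b₁ ≡ zeroB ⊎ b₂ ≡ zeroB
mergeB≡zeroB⁻ star  _ = inj₂
mergeB≡zeroB⁻ zeroB _ = λ _ → inj₁ refl

module _ (K L : ℕ) where

  OnProg : ℕ → Set
  OnProg m = ∃ λ s → m ≡ K + s * L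

  OnProg? : Decidable OnProg
  OnProg? m = map′ from to (K ≤? m ×-dec L ∣? (m ∸ K))
    where
    from : K ≤ m × L ∣ m ∸ K → OnProg m
    from (K≤m , divides s eq) = s , trans (sym (m+[n∸m]≡n K≤m)) (cong (K +_) eq)
    to : OnProg m → K ≤ m × L ∣ m ∸ K
    to (s , eq) rewrite eq = m≤m+n K (s * L) , divides s (m+n∸m≡n K (s * L))

  OnProg-+ : ∀ {m d} → OnProg m → L ∣ d → OnProg (m + d)
  OnProg-+ (s , refl) (divides q refl) =
    s + q , trans (+-assoc K (s * L) (q * L)) (cong (K +_) (sym (*-distribʳ-+ L s q)))

  OnProg-∣-∣ : ∀ {m m′} → OnProg m → OnProg m′ → L ∣ ∣ m - m′ ∣
  OnProg-∣-∣ (s , refl) (s′ , refl) =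
    divides ∣ s - s′ ∣ (trans (∣m+n-m+o∣≡∣n-o∣ K _ _) (sym (*-distribʳ-∣-∣ L s s′)))

  OnProg-≤ : ∀ t {a c} → a ≤ c → L ∣ ∣ a - c ∣ → OnProg (t + a) → OnProg (t + c)
  OnProg-≤ t a≤c L∣a-c onProg =
    subst OnProg (trans (+-assoc t _ _) (cong (t +_) (m+[n∸m]≡n a≤c)))
          (OnProg-+ onProg (subst (L ∣_) (m≤n⇒∣m-n∣≡n∸m a≤c) L∣a-c))

  OnProg-⊓⁻ : ∀ t a c → L ∣ ∣ a - c ∣ → OnProg (t + a ⊓ c) → OnProg (t + a) × OnProg (t + c)
  OnProg-⊓⁻ t a c L∣a-c with ≤-total a c
  ... | inj₁ a≤c rewrite m≤n⇒m⊓n≡m a≤c = λ onProg → onProg , OnProg-≤ t a≤c L∣a-c onProg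
  ... | inj₂ c≤a rewrite m≥n⇒m⊓n≡n c≤a =
    λ onProg → OnProg-≤ t c≤a (subst (L ∣_) (∣-∣-comm a c) L∣a-c) onProg , onProg

  OnProg-⊓⁺ : ∀ t a c → OnProg (t + a) → OnProg (t + c) → OnProg (t + a ⊓ c)
  OnProg-⊓⁺ t a c with ⊓-sel a c
  ... | inj₁ a⊓c≡a rewrite a⊓c≡a = λ onProg _ → onProg
  ... | inj₂ a⊓c≡c rewrite a⊓c≡c = λ _ onProg → onProg

  Anchored : ℕ → Maybe ℕ → Set
  Anchored t k = ∀ k′ → k ≡ just k′ → OnProg (t + k′)

  Anchored-merge⁻ : ∀ t k₁ k₂ {l₁ l₂} → Anchored t (mergeK k₁ k₂) → L ∣ mergeL k₁ k₂ l₁ l₂ →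
                    (Anchored t k₁ × L ∣ l₁) × (Anchored t k₂ × L ∣ l₂)
  Anchored-merge⁻ t nothing  k₂       {l₁} {l₂} h L∣gcd =
    ((λ _ ()) , ∣-trans L∣gcd (gcd[m,n]∣m l₁ l₂)) , (h , ∣-trans L∣gcd (gcd[m,n]∣n l₁ l₂))
  Anchored-merge⁻ t (just a) nothing  {l₁} {l₂} h L∣gcd =
    (h , ∣-trans L∣gcd (gcd[m,n]∣m l₁ l₂)) , ((λ _ ()) , ∣-trans L∣gcd (gcd[m,n]∣n l₁ l₂))
  Anchored-merge⁻ t (just a) (just c) {l₁} {l₂} h L∣gcd
    with OnProg-⊓⁻ t a c (∣-trans L∣gcd (gcd[m,n]∣n (gcd l₁ l₂) ∣ a - c ∣)) (h _ refl)
  ... | onProg-a , onProg-c =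
    ((λ { _ refl → onProg-a }) , ∣-trans L∣gcd′ (gcd[m,n]∣m l₁ l₂)) ,
    ((λ { _ refl → onProg-c }) , ∣-trans L∣gcd′ (gcd[m,n]∣n l₁ l₂))
    where L∣gcd′ = ∣-trans L∣gcd (gcd[m,n]∣m (gcd l₁ l₂) ∣ a - c ∣)

  Anchored-merge⁺ : ∀ t k₁ k₂ {l₁ l₂} → Anchored t k₁ → Anchored t k₂ → L ∣ l₁ → L ∣ l₂ →
                    Anchored t (mergeK k₁ k₂) × L ∣ mergeL k₁ k₂ l₁ l₂
  Anchored-merge⁺ t nothing  k₂       _  h₂ L∣l₁ L∣l₂ = h₂ , gcd-greatest L∣l₁ L∣l₂
  Anchored-merge⁺ t (just a) nothing  h₁ _  L∣l₁ L∣l₂ = h₁ , gcd-greatest L∣l₁ L∣l₂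
  Anchored-merge⁺ t (just a) (just c) h₁ h₂ L∣l₁ L∣l₂ =
    (λ { _ refl → OnProg-⊓⁺ t a c (h₁ a refl) (h₂ c refl) }) ,
    gcd-greatest (gcd-greatest L∣l₁ L∣l₂)
                 (subst (L ∣_) (∣m+n-m+o∣≡∣n-o∣ t a c) (OnProg-∣-∣ (h₁ a refl) (h₂ c refl)))

  InR-merge⁻ : ∀ λ₁ λ₂ {t} → InR K L (merge λ₁ λ₂) t → InR K L λ₁ t × InR K L λ₂ t
  InR-merge⁻ (lab b₁ k₁ l₁) (lab b₂ k₂ l₂) {t} (t≡0 , anchored , L∣l)
    with Anchored-merge⁻ t k₁ k₂ anchored L∣l
  ... | (anchored₁ , L∣l₁) , (anchored₂ , L∣l₂) =
    ((λ { refl → t≡0 (mergeB-zeroBˡ b₂) }) , anchored₁ , L∣l₁) ,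
    ((λ { refl → t≡0 (mergeB-zeroBʳ b₁) }) , anchored₂ , L∣l₂)

  InR-merge⁺ : ∀ λ₁ λ₂ {t} → InR K L λ₁ t → InR K L λ₂ t → InR K L (merge λ₁ λ₂) t
  InR-merge⁺ (lab b₁ k₁ l₁) (lab b₂ k₂ l₂) {t}
             (t≡0₁ , anchored₁ , L∣l₁) (t≡0₂ , anchored₂ , L∣l₂)
    with Anchored-merge⁺ t k₁ k₂ anchored₁ anchored₂ L∣l₁ L∣l₂
  ... | anchored , L∣l = [ t≡0₁ , t≡0₂ ]′ ∘ mergeB≡zeroB⁻ b₁ b₂ , anchored , L∣l

  InR? : ∀ λ′ t → Dec (InR K L λ′ t)
  InR? (lab b k l) t = zero? b ×-dec anchored? k ×-dec L ∣? l
    where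
    zero? : ∀ b → Dec (b ≡ zeroB → t ≡ 0)
    zero? star  = yes λ ()
    zero? zeroB = map′ (λ t≡0 _ → t≡0) (λ t≡0 → t≡0 refl) (t ≟ 0)
    anchored? : ∀ k → Dec (Anchored t k)
    anchored? nothing  = yes λ _ ()
    anchored? (just a) =
      map′ (λ { onProg _ refl → onProg }) (λ anchored → anchored a refl) (OnProg? (t + a))

  Anchored-suc⁺ : ∀ t k → Anchored (suc t) k → Anchored t (Maybe.map suc k)
  Anchored-suc⁺ t nothing  _ _ ()
  Anchored-suc⁺ t (just a) h _ refl = subst OnProg (sym (+-suc t a)) (h a refl)

  Anchored-suc⁻ : ∀ t k → Anchored t (Maybe.map suc k) → Anchored (suc t) k
  Anchored-suc⁻ t nothing  _ _ ()
  Anchored-suc⁻ t (just a) h _ refl = subst OnProg (+-suc t a) (h (suc a) refl)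

  InR-timeShift⁺ : ∀ {t} → TimeShift c c′ → InR K L (label c) (suc t) → InR K L (label c′) t
  InR-timeShift⁺ {t = t} (ts {k}) (_ , anchored , L∣l) = (λ ()) , Anchored-suc⁺ t k anchored , L∣l

  InR-timeShift⁻ : ∀ {t} → TimeShift c c′ → InR K L (label c′) t → InR K L (label c) (suc t)
  InR-timeShift⁻ {t = t} (ts {k}) (_ , anchored , L∣l) = (λ ()) , Anchored-suc⁻ t k anchored , L∣l

  timeShifts-by : ∀ (c : LClause n) d {u} → InR K L (label c) (d + u) →
                  ∃ λ c′ → TimeShifts c c′ × clause c′ ≡ shiftC d (clause c) × InR K L (label c′) u
  timeShifts-by c zero t∈R = c , ε , sym (shiftC-zero (clause c)) , t∈R
  timeShifts-by (⟨ lab star k l ⟩ C) (suc d) t∈R =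
    let c′ , shifts , c′≡ , u∈R = timeShifts-by (⟨ lab star (Maybe.map suc k) l ⟩ shiftC 1 C) d
                                                (InR-timeShift⁺ (ts {C = C}) t∈R)
    in c′ , ts ◅ shifts , trans c′≡ (shiftC-+ d 1 C) , u∈R
  timeShifts-by (⟨ lab zeroB k l ⟩ C) (suc d) (t≡0 , _) with t≡0 refl
  ... | ()

  _⊨_ : Valuation n → LClause n → Set
  W ⊨ c = ∀ t → InR K L (label c) t → SatClause W (shiftC t (clause c))

  ⊨-timeShift : TimeShift c c′ → W ⊨ c → W ⊨ c′
  ⊨-timeShift {W = W} shift@(ts {C = C}) W⊨c t t∈R =
    subst (SatClause W) (sym (shiftC-+ t 1 C)) (W⊨c (suc t) (InR-timeShift⁻ shift t∈R))

  ⊨-timeShifts : TimeShifts c c′ → W ⊨ c → W ⊨ c′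
  ⊨-timeShifts ε               = id
  ⊨-timeShifts (shift ◅ shifts) = ⊨-timeShifts shifts ∘ ⊨-timeShift shift

  module Soundness {n} (N : List (LClause n)) (p : Fin n)
                   (cnt : ∀ c → c ∈ N → countP p (clause c) ≤ 1)
                   (W : Valuation n) (W⊨N : ∀ c → c ∈ N → W ⊨ c) where

    premise : ∀ {c d} → c ∈ N → TimeShifts c d → W ⊨ d × countP p (clause d) ≤ 1
    premise c∈N shifts =
      ⊨-timeShifts shifts (W⊨N _ c∈N) , subst (_≤ 1) (sym (countP-timeShifts p shifts)) (cnt _ c∈N)

    W⊨resolvent : ∀ {c₁ c₂ d₁ d₂ i} → c₁ ∈ N → c₂ ∈ N → TimeShifts c₁ d₁ × TimeShifts c₂ d₂ →
                  pos (p , i) ∈ clause d₁ → neg (p , i) ∈ clause d₂ → W ⊨ resolve (p , i) d₁ d₂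
    W⊨resolvent {d₁ = d₁} {d₂} c₁∈N c₂∈N (shifts₁ , shifts₂) pos∈ neg∈ t t∈R =
      let W⊨d₁ , cnt₁ = premise c₁∈N shifts₁
          W⊨d₂ , cnt₂ = premise c₂∈N shifts₂
          t∈R₁ , t∈R₂ = InR-merge⁻ (label d₁) (label d₂) t∈R
      in SatClause-shiftC⁺ (resolvent-sound (SatClause-shiftC⁻ (W⊨d₁ t t∈R₁))
                                            (SatClause-shiftC⁻ (W⊨d₂ t t∈R₂))
                                            (countP≤1⇒onlyLiteral {p = p} cnt₁ pos∈ refl)
                                            (countP≤1⇒onlyLiteral {p = p} cnt₂ neg∈ refl))

    W⊨N̄ : ∀ r → Nbar N p r → W ⊨ r
    W⊨N̄ r (inj₂ (r∈N , _)) = W⊨N r r∈N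
    W⊨N̄ _ (inj₁ (_ , _ , c₁∈N , _ , c₂∈N , _ , _ , _ , shifts , _ , pos∈ , neg∈ , refl)) =
      W⊨resolvent c₁∈N c₂∈N (resolventPremises shifts) pos∈ neg∈

  module Completeness {n} (N : List (LClause n)) (p : Fin n)
                      (cnt : ∀ c → c ∈ N → countP p (clause c) ≤ 1)
                      (W : Valuation n) (W⊨N̄ : ∀ r → Nbar N p r → W ⊨ r) where

    OnlyVia : (Lit n → Set) → LClause n → ℕ → Set
    OnlyVia P c t = InR K L (label c) t × OnlyTrue P (W ∘ shiftAtom t) (clause c)

    NeedsNeg : ℕ → LClause n → Lit n → Set
    NeedsNeg j c (pos _)       = ⊥
    NeedsNeg j c (neg (q , i)) = q ≡ p × i ≤ j × OnlyVia (IsP p) c (j ∸ i)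

    Needed : ℕ → Set
    Needed j = Any (λ c → Any (NeedsNeg j c) (clause c)) N

    needed? : Decidable Needed
    needed? j = any? (λ c → any? (needsNeg? c) (clause c)) N
      where
      needsNeg? : ∀ c → Decidable (NeedsNeg j c)
      needsNeg? c (pos _)       = no λ ()
      needsNeg? c (neg (q , i)) =
        q FinP.≟ p ×-dec i ≤? j ×-dec InR? (label c) (j ∸ i) ×-dec OnlyTrue? (IsP? p) _ (clause c)

    W′ : Valuation n
    W′ (q , j) = if does (q FinP.≟ p) then not (does (needed? j)) else W (q , j)

    W′-off-p : ∀ {q} j → ¬ q ≡ p → W′ (q , j) ≡ W (q , j)
    W′-off-p {q} j q≢p rewrite dec-false (q FinP.≟ p) q≢p = refl

    W′-needed : ∀ {j} → Needed j → W′ (p , j) ≡ false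
    W′-needed {j} need rewrite dec-true (p FinP.≟ p) refl | dec-true (needed? j) need = refl

    W′-unneeded : ∀ {j} → ¬ Needed j → W′ (p , j) ≡ true
    W′-unneeded {j} ¬need rewrite dec-true (p FinP.≟ p) refl | dec-false (needed? j) ¬need = refl

    LitTrue-W′ : ∀ t x → ¬ IsP p x → LitTrue (W ∘ shiftAtom t) x → LitTrue (W′ ∘ shiftAtom t) x
    LitTrue-W′ t (pos (_ , i)) q≢p = trans (W′-off-p (i + t) q≢p)
    LitTrue-W′ t (neg (_ , i)) q≢p = trans (W′-off-p (i + t) q≢p)

    pinned : ∀ {c ℓ t} → c ∈ N → ℓ ∈ clause c → IsP p ℓ →
             OnlyVia (IsP p) c t → OnlyVia (AtAtom (atom ℓ)) c t
    pinned c∈N ℓ∈ pℓ (t∈R , only) = t∈R , All.tabulate λ x∈ x-true →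
      cong atom (countP≤1⇒unique (cnt _ c∈N) x∈ ℓ∈ (All.lookup only x∈ x-true) pℓ)

    pinned-timeShifts : ∀ {c A} d {u} → OnlyVia (AtAtom A) c (d + u) →
                        ∃ λ c′ → TimeShifts c c′ × clause c′ ≡ shiftC d (clause c) ×
                                 OnlyVia (AtAtom (shiftAtom d A)) c′ u
    pinned-timeShifts {c} d {u} (t∈R , only) with timeShifts-by c d t∈R
    ... | c′ , shifts , c′≡ , u∈R =
      c′ , shifts , c′≡ , u∈R , subst (OnlyTrue _ _) (sym c′≡) (OnlyTrue-shiftC {W = W} d u only)

    refute : ∀ {c₁ c₂ d₁ d₂ i t} → c₁ ∈ N → HasPosP p c₁ → c₂ ∈ N → HasNegP p c₂ →
             (TimeShifts c₁ d₁ × d₂ ≡ c₂) ⊎ (d₁ ≡ c₁ × TimeShifts c₂ d₂) →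
             pos (p , i) ∈ clause d₁ → neg (p , i) ∈ clause d₂ →
             OnlyVia (AtAtom (p , i)) d₁ t → OnlyVia (AtAtom (p , i)) d₂ t → ⊥
    refute {d₁ = d₁} {d₂} {t = t} c₁∈N c₁⁺ c₂∈N c₂⁻ shifts pos∈ neg∈ (t∈R₁ , only₁) (t∈R₂ , only₂) =
      resolvent-unsat only₁ only₂ (SatClause-shiftC⁻ (W⊨N̄ _ resolvent∈N̄ t t∈R))
      where
      resolvent∈N̄ = inj₁ (_ , _ , c₁∈N , c₁⁺ , c₂∈N , c₂⁻ , d₁ , d₂ , shifts , _ , pos∈ , neg∈ , refl)
      t∈R = InR-merge⁺ (label d₁) (label d₂) t∈R₁ t∈R₂

    conflict : ∀ {c₁ c₂ i₁ i₂ t₁ t₂} →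
               c₁ ∈ N → pos (p , i₁) ∈ clause c₁ → OnlyVia (IsP p) c₁ t₁ →
               c₂ ∈ N → neg (p , i₂) ∈ clause c₂ → OnlyVia (IsP p) c₂ t₂ →
               i₁ + t₁ ≡ i₂ + t₂ → ⊥
    conflict {i₁ = i₁} {i₂} c₁∈N pos∈ via₁ c₂∈N neg∈ via₂ eq with ≤-total i₁ i₂
    ... | inj₁ i₁≤i₂ with equal-sums-offset eq i₁≤i₂
    ...   | d , refl , refl =
      let c₁′ , shifts , c₁′≡ , pin₁ = pinned-timeShifts d (pinned c₁∈N pos∈ refl via₁)
      in refute c₁∈N (_ , pos∈) c₂∈N (_ , neg∈) (inj₁ (shifts , refl))
                (subst (_ ∈_) (sym c₁′≡) (∈-map⁺ (shiftLit d) pos∈)) neg∈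
                pin₁ (pinned c₂∈N neg∈ refl via₂)
    conflict c₁∈N pos∈ via₁ c₂∈N neg∈ via₂ eq | inj₂ i₂≤i₁ with equal-sums-offset (sym eq) i₂≤i₁
    ...   | d , refl , refl =
      let c₂′ , shifts , c₂′≡ , pin₂ = pinned-timeShifts d (pinned c₂∈N neg∈ refl via₂)
      in refute c₁∈N (_ , pos∈) c₂∈N (_ , neg∈) (inj₂ (refl , shifts))
                pos∈ (subst (_ ∈_) (sym c₂′≡) (∈-map⁺ (shiftLit d) neg∈))
                (pinned c₁∈N pos∈ refl via₁) pin₂

    needed : ∀ {c i t} → c ∈ N → neg (p , i) ∈ clause c → OnlyVia (IsP p) c t → Needed (i + t)
    needed {c} {i} {t} c∈N neg∈ via =
      lose c∈N (lose neg∈ (refl , m≤m+n i t , subst (OnlyVia (IsP p) c) (sym (m+n∸m≡n i t)) via))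

    unneeded : ∀ {c i t} → c ∈ N → pos (p , i) ∈ clause c → OnlyVia (IsP p) c t → ¬ Needed (i + t)
    unneeded c∈N pos∈ via need with find need
    ... | _ , c₂∈N , needs with find needs
    ...   | neg _ , neg∈ , (refl , i₂≤j , via₂) =
      conflict c∈N pos∈ via c₂∈N neg∈ via₂ (sym (m+[n∸m]≡n i₂≤j))

    W′⊨N : ∀ c → c ∈ N → W′ ⊨ c
    W′⊨N c c∈N t t∈R = SatClause-shiftC⁺ (decidable-stable (SatClause? _ (clause c)) refuted)
      where
      via : ¬ SatClause (W′ ∘ shiftAtom t) (clause c) → OnlyVia (IsP p) c t
      via unsat = t∈R , All.tabulate λ {x} x∈ x-true →
        decidable-stable (IsP? p x) λ ¬px → unsat (lose x∈ (LitTrue-W′ t x ¬px x-true))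

      refuted : ¬ ¬ SatClause (W′ ∘ shiftAtom t) (clause c)
      refuted unsat with any? (IsP? p) (clause c)
      ... | no noP with find (SatClause-shiftC⁻ (W⊨N̄ c (inj₂ (c∈N , AllP.¬Any⇒All¬ _ noP)) t t∈R))
      ...   | x , x∈ , x-true = noP (lose x∈ (All.lookup (proj₂ (via unsat)) x∈ x-true))
      refuted unsat | yes hasP with find hasP
      ... | pos _ , pos∈ , refl = unsat (lose pos∈ (W′-unneeded (unneeded c∈N pos∈ (via unsat))))
      ... | neg _ , neg∈ , refl = unsat (lose neg∈ (W′-needed (needed c∈N neg∈ (via unsat))))

theorem1 : (n : ℕ) (N : List (LClause n)) (p : Fin n) →
           (∀ lc → lc ∈ N → countP p (clause lc) ≤ 1) →
           (K L : ℕ) → 0 < L →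
           (KLSat K L (λ lc → lc ∈ N) → KLSat K L (Nbar N p)) ×
           (KLSat K L (Nbar N p) → KLSat K L (λ lc → lc ∈ N))
theorem1 n N p cnt K L _ =
  (λ (W , W⊨N) → W , Soundness.W⊨N̄ K L N p cnt W W⊨N) ,
  (λ (W , W⊨N̄) → let open Completeness K L N p cnt W W⊨N̄ in W′ , W′⊨N)
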